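{- For every term $\mathbf{t}$, type $T$, context $\Gamma$ and $n\in\mathbb{N}$: if $\Gamma\vdash\lambda x\,\mathbf{t}:T$ is derivable with a derivation of size $n$, then there exist a unit type $U$, a type $R$ and $m<n$ such that $\Gamma,x:U\vdash\mathbf{t}:R$ is derivable with a derivation of size $m$ and $U\to R\preceq T$.
   Context: Lineal terms over a commutative ring $(\mathcal{S},+,\times)$: basis terms $\mathbf{b}::=x\mid\lambda x\,\mathbf{t}$, terms $\mathbf{t}::=\mathbf{b}\mid(\mathbf{t})~\mathbf{r}\mid\mathbf{0}\mid\alpha.\mathbf{t}\mid\mathbf{t}+\mathbf{r}$, modulo AC of $+$. Scalar type system: types $T::=U\mid\forall X.T\mid\alpha.T\mid\overline{0}$, unit types $U::=X\mid U\to T\mid\forall X.U$, substitution of type variables only by unit types; $\equiv$ is the least congruence with $\alpha.\overline{0}\equiv\overline{0}$, $0.T\equiv\overline{0}$, $1.T\equiv T$, $\alpha.(\beta.T)\equiv(\alpha\times\beta).T$, $\forall X.\alpha.T\equiv\alpha.\forall X.T$. Contexts: finite sets of $x:U$ ($U$ unit). Rules: (ax) $\Gamma,x:U\vdash x:U$; ($\equiv$) from $\Gamma\vdash\mathbf{t}:T$, $T\equiv S$ infer $\Gamma\vdash\mathbf{t}:S$; ($\to_E$) from $\Gamma\vdash\mathbf{t}:\alpha.(U\to T)$, $\Gamma\vdash\mathbf{r}:\beta.U$ infer $\Gamma\vdash(\mathbf{t})~\mathbf{r}:(\alpha\times\beta).T$; ($\to_I$) from $\Gamma,x:U\vdash\mathbf{t}:T$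 infer $\Gamma\vdash\lambda x\,\mathbf{t}:U\to T$; ($\forall_E$) from $\Gamma\vdash\mathbf{t}:\forall X.T$ infer $\Gamma\vdash\mathbf{t}:T[U/X]$; ($\forall_I$) from $\Gamma\vdash\mathbf{t}:T$ infer $\Gamma\vdash\mathbf{t}:\forall X.T$ if $X$ not free in $\Gamma$; ($ax_{\overline{0}}$) $\Gamma\vdash\mathbf{0}:\overline{0}$; ($+_I$) from $\Gamma\vdash\mathbf{t}:\alpha.T$, $\Gamma\vdash\mathbf{r}:\beta.T$ infer $\Gamma\vdash\mathbf{t}+\mathbf{r}:(\alpha+\beta).T$; ($s_I$) from $\Gamma\vdash\mathbf{t}:T$ infer $\Gamma\vdash\alpha.\mathbf{t}:\alpha.T$. Size of a derivation: applications of $\equiv$ are ignored; a derivation whose last non-$\equiv$ rule is an axiom has size $0$; otherwise $1+$ the maximum size of the premises' derivations of its last non-$\equiv$ rule. Order: $T\prec R$ if $R\equiv\forall X.T$, or $T\equiv\forall X.S$ and $R\equiv S[U/X]$ for some unit $U$; $\preceq$ is the reflexive-transitive closure of $\prec$. -}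

module Defs where

open import Level using (_⊔_)
open import Algebra.Bundles using (CommutativeRing)
open import Data.Nat using (ℕ; zero; suc; _≟_) renaming (_⊔_ to _⊔ℕ_)
open import Data.List using (List; []; _∷_; map)
open import Data.Product using (Σ; ∃; _×_; _,_)
open import Data.Sum using (_⊎_)
open import Relation.Nullary using (yes; no)
open import Relation.Binary.Construct.Closure.ReflexiveTransitive using (Star)

module Lineal {c ℓ} (𝒮 : CommutativeRing c ℓ) where

  open CommutativeRing 𝒮 using (_≈_; 0#; 1#) renaming (Carrier to S; _+_ to _+ₛ_; _*_ to _*ₛ_)

  infixl 7 _⋆_
  infixl 6 _⊕_
  data Tm : Set c where
    var : ℕ → Tm
    ƛ   : Tm → Tm
    _∙_ : Tm → Tm → Tm
    𝟎   : Tm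
    _⋆_ : S → Tm → Tm
    _⊕_ : Tm → Tm → Tm

  -- Terms are taken modulo associativity and commutativity of +
  -- (and scalars up to the ring's equality): the least congruence.
  data _~_ : Tm → Tm → Set (c ⊔ ℓ) where
    ~refl  : ∀ {t} → t ~ t
    ~sym   : ∀ {t r} → t ~ r → r ~ t
    ~trans : ∀ {t r s} → t ~ r → r ~ s → t ~ s
    ~comm  : ∀ {t r} → (t ⊕ r) ~ (r ⊕ t)
    ~assoc : ∀ {t r s} → ((t ⊕ r) ⊕ s) ~ (t ⊕ (r ⊕ s))
    ~ƛ     : ∀ {t t'} → t ~ t' → ƛ t ~ ƛ t'
    ~app   : ∀ {t t' r r'} → t ~ t' → r ~ r' → (t ∙ r) ~ (t' ∙ r')
    ~scal  : ∀ {α β t t'} → α ≈ β → t ~ t' → (α ⋆ t) ~ (β ⋆ t')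
    ~plus  : ∀ {t t' r r'} → t ~ t' → r ~ r' → (t ⊕ r) ~ (t' ⊕ r')

  -- Types: raw syntax (de Bruijn indices for type variables),
  -- with predicates carving out unit types and types.

  infixr 5 _⇒_
  infixr 7 _·_
  data Ty : Set c where
    tvar : ℕ → Ty
    _⇒_  : Ty → Ty → Ty
    ∀̇    : Ty → Ty
    _·_  : S → Ty → Ty
    𝟘    : Ty

  mutual
    data IsUnit : Ty → Set c where
      u-var : ∀ {i} → IsUnit (tvar i)
      u-⇒   : ∀ {U T} → IsUnit U → IsType T → IsUnit (U ⇒ T)
      u-∀   : ∀ {U} → IsUnit U → IsUnit (∀̇ U)

    data IsType : Ty → Set c where
      t-unit : ∀ {U} → IsUnit U → IsType U
      t-∀    : ∀ {T} → IsType T → IsType (∀̇ T)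
      t-·    : ∀ {α T} → IsType T → IsType (α · T)
      t-𝟘    : IsType 𝟘

  ext : (ℕ → ℕ) → ℕ → ℕ
  ext ρ zero    = zero
  ext ρ (suc i) = suc (ρ i)

  rename : (ℕ → ℕ) → Ty → Ty
  rename ρ (tvar i) = tvar (ρ i)
  rename ρ (U ⇒ T)  = rename ρ U ⇒ rename ρ T
  rename ρ (∀̇ T)    = ∀̇ (rename (ext ρ) T)
  rename ρ (α · T)  = α · rename ρ T
  rename ρ 𝟘        = 𝟘

  exts : (ℕ → Ty) → ℕ → Ty
  exts σ zero    = tvar zero
  exts σ (suc i) = rename suc (σ i)

  subst : (ℕ → Ty) → Ty → Ty
  subst σ (tvar i) = σ i
  subst σ (U ⇒ T)  = subst σ U ⇒ subst σ T
  subst σ (∀̇ T)    = ∀̇ (subst (exts σ) T)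
  subst σ (α · T)  = α · subst σ T
  subst σ 𝟘        = 𝟘

  single : Ty → ℕ → Ty
  single U zero    = U
  single U (suc i) = tvar i

  _[_] : Ty → Ty → Ty
  T [ U ] = subst (single U) T

  ↑ : Ty → Ty
  ↑ = rename suc

  -- "close k": the body of ∀X.T when X is the free variable k
  -- (k becomes the bound index 0, every other free variable is shifted)
  closeVar : ℕ → ℕ → ℕ
  closeVar k i with i ≟ k
  ... | yes _ = zero
  ... | no  _ = suc i

  close : ℕ → Ty → Ty
  close k = rename (closeVar k)

  infix 4 _≅_
  data _≅_ : Ty → Ty → Set (c ⊔ ℓ) where
    ≅-zero-scal : ∀ {α} → (α · 𝟘) ≅ 𝟘
    ≅-scal-zero : ∀ {T} → IsType T → (0# · T) ≅ 𝟘
    ≅-one       : ∀ {T} → IsType T → (1# · T) ≅ T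
    ≅-mul       : ∀ {α β T} → IsType T → (α · (β · T)) ≅ ((α *ₛ β) · T)
    ≅-∀scal     : ∀ {α T} → IsType T → ∀̇ (α · T) ≅ α · ∀̇ T
    ≅-refl      : ∀ {T} → IsType T → T ≅ T
    ≅-sym       : ∀ {T S} → T ≅ S → S ≅ T
    ≅-trans     : ∀ {T S R} → T ≅ S → S ≅ R → T ≅ R
    ≅-⇒         : ∀ {U U' T T'} → IsUnit U → IsUnit U' → U ≅ U' → T ≅ T' → (U ⇒ T) ≅ (U' ⇒ T')
    ≅-∀         : ∀ {T T'} → T ≅ T' → ∀̇ T ≅ ∀̇ T'
    ≅-·         : ∀ {α β T T'} → α ≈ β → T ≅ T' → (α · T) ≅ (β · T')

  -- Contexts (de Bruijn: Γ , x : U  is  U ∷ Γ)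

  Ctx : Set c
  Ctx = List Ty

  data _∋_∶_ : Ctx → ℕ → Ty → Set c where
    here  : ∀ {Γ U} → (U ∷ Γ) ∋ zero ∶ U
    there : ∀ {Γ U V i} → Γ ∋ i ∶ U → (V ∷ Γ) ∋ suc i ∶ U

  -- Typing derivations, indexed by their size.
  -- The rules (≡) and (AC: terms are considered modulo AC) do not count.

  infix 3 _⊢_∶_[_]
  data _⊢_∶_[_] : Ctx → Tm → Ty → ℕ → Set (c ⊔ ℓ) where
    ax    : ∀ {Γ i U} → Γ ∋ i ∶ U → Γ ⊢ var i ∶ U [ 0 ]
    ≡-rule : ∀ {Γ t T S n} → Γ ⊢ t ∶ T [ n ] → T ≅ S → Γ ⊢ t ∶ S [ n ]
    ac    : ∀ {Γ t r T n} → t ~ r → Γ ⊢ t ∶ T [ n ] → Γ ⊢ r ∶ T [ n ]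
    →E    : ∀ {Γ t r α β U T n m} →
            Γ ⊢ t ∶ α · (U ⇒ T) [ n ] → Γ ⊢ r ∶ β · U [ m ] →
            Γ ⊢ t ∙ r ∶ (α *ₛ β) · T [ suc (n ⊔ℕ m) ]
    →I    : ∀ {Γ t U T n} → IsUnit U →
            (U ∷ Γ) ⊢ t ∶ T [ n ] → Γ ⊢ ƛ t ∶ U ⇒ T [ suc n ]
    ∀E    : ∀ {Γ t T U n} → IsUnit U →
            Γ ⊢ t ∶ ∀̇ T [ n ] → Γ ⊢ t ∶ T [ U ] [ suc n ]
    -- "X not free in Γ": in de Bruijn form the premise is typed in the
    -- shifted context, X being the fresh index 0
    ∀I    : ∀ {Γ t T n} → map ↑ Γ ⊢ t ∶ T [ n ] → Γ ⊢ t ∶ ∀̇ T [ suc n ]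
    ax𝟘   : ∀ {Γ} → Γ ⊢ 𝟎 ∶ 𝟘 [ 0 ]
    +I    : ∀ {Γ t r α β T n m} →
            Γ ⊢ t ∶ α · T [ n ] → Γ ⊢ r ∶ β · T [ m ] →
            Γ ⊢ t ⊕ r ∶ (α +ₛ β) · T [ suc (n ⊔ℕ m) ]
    sI    : ∀ {Γ t T α n} → Γ ⊢ t ∶ T [ n ] → Γ ⊢ α ⋆ t ∶ α · T [ suc n ]

  infix 4 _≺_ _⪯_
  _≺_ : Ty → Ty → Set (c ⊔ ℓ)
  T ≺ R = (∃ λ k → R ≅ ∀̇ (close k T))
        ⊎ (Σ Ty λ S → Σ Ty λ U → IsUnit U × T ≅ ∀̇ S × R ≅ S [ U ])

  _⪯_ : Ty → Ty → Set (c ⊔ ℓ)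
  _⪯_ = Star _≺_

-- Only five rules can end in an abstraction: (→I) yields the
-- premise itself; (≡) and the AC rule change the type within ≅ (which ⪯ absorbs) or the body
-- within ~; (∀E) adds one ≺ step. For (∀I) the premise lives in the shifted context Γ↑, so the
-- result of the induction hypothesis is renamed back along a permutation that sends the bound
-- variable to a variable N fresh for Γ and T; the renamed type then generalizes over N to ∀X.T.
-- Every rule passed on the way only increases the size.

module Submission where

open import Defs
open import Algebra.Bundles using (CommutativeRing)
open import Data.Nat using (ℕ; _<_)
open import Data.List using (List; _∷_)
open import Data.List.Relation.Unary.All using (All)
open import Data.Product using (Σ; _×_)

open import Level using (_⊔_)
open import Function using (_∘_)
open import Function.Definitions using (Injective)
open import Data.Nat using (zero; suc; pred; _≤_; _<?_; _≟_) renaming (_⊔_ to _⊔ℕ_)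
open import Data.Nat.Properties
  using (≤-refl; n≤1+n; n<1+n; <-trans; <-≤-trans; <⇒≢; <⇒≤pred; m≤m⊔n; m≤n⊔m)
open import Data.List using (map)
open import Data.List.Properties using (map-∘; map-cong; map-id-local)
import Data.List.Relation.Unary.All as All
open import Data.List.Relation.Unary.All.Properties using (map⁻)
open import Data.List.Extrema.Nat using (max; ⊥≤max; xs≤max)
open import Data.Maybe using (Maybe; just; nothing)
import Data.Maybe.Relation.Binary.Pointwise as Pointwise
open Pointwise using (Pointwise; just; nothing)
open import Data.Product using (_,_; proj₁; proj₂)
open import Data.Sum using (inj₁; inj₂)
open import Relation.Nullary using (yes; no; contradiction)
open import Relation.Binary.PropositionalEquality
  using (_≡_; _≢_; _≗_; refl; sym; trans; cong; cong₂) renaming (subst to ≡-subst)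
open import Relation.Binary.Construct.Closure.ReflexiveTransitive using (ε; _◅_; _◅◅_; gmap)

module _ {c ℓ} (𝒮 : CommutativeRing c ℓ) where
  open Lineal 𝒮

  private variable
    Γ : Ctx
    s t : Tm
    A B T : Ty
    n n' : ℕ
    f g ρ : ℕ → ℕ
    σ τ : ℕ → Ty

  lamBody : Tm → Maybe Tm
  lamBody (ƛ t) = just t
  lamBody _     = nothing

  lamBody-~ : s ~ t → Pointwise _~_ (lamBody s) (lamBody t)
  lamBody-~ ~refl          = Pointwise.refl ~refl
  lamBody-~ (~sym p)       = Pointwise.sym ~sym (lamBody-~ p)
  lamBody-~ (~trans p q)   = Pointwise.trans ~trans (lamBody-~ p) (lamBody-~ q)
  lamBody-~ ~comm          = nothing
  lamBody-~ ~assoc         = nothing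
  lamBody-~ (~ƛ p)         = just p
  lamBody-~ (~app _ _)     = nothing
  lamBody-~ (~scal _ _)    = nothing
  lamBody-~ (~plus _ _)    = nothing

  ext-cong : f ≗ g → ext f ≗ ext g
  ext-cong f≗g zero    = refl
  ext-cong f≗g (suc i) = cong suc (f≗g i)

  rename-cong : f ≗ g → rename f ≗ rename g
  rename-cong f≗g (tvar i) = cong tvar (f≗g i)
  rename-cong f≗g (A ⇒ B)  = cong₂ _⇒_ (rename-cong f≗g A) (rename-cong f≗g B)
  rename-cong f≗g (∀̇ A)    = cong ∀̇ (rename-cong (ext-cong f≗g) A)
  rename-cong f≗g (α · A)  = cong (α ·_) (rename-cong f≗g A)
  rename-cong f≗g 𝟘        = refl

  ext-∘ : ∀ f g → ext f ∘ ext g ≗ ext (f ∘ g)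
  ext-∘ f g zero    = refl
  ext-∘ f g (suc i) = refl

  rename-∘ : ∀ f g → rename f ∘ rename g ≗ rename (f ∘ g)
  rename-∘ f g (tvar i) = refl
  rename-∘ f g (A ⇒ B)  = cong₂ _⇒_ (rename-∘ f g A) (rename-∘ f g B)
  rename-∘ f g (∀̇ A)    =
    cong ∀̇ (trans (rename-∘ (ext f) (ext g) A) (rename-cong (ext-∘ f g) A))
  rename-∘ f g (α · A)  = cong (α ·_) (rename-∘ f g A)
  rename-∘ f g 𝟘        = refl

  rename-ext-↑ : ∀ ρ A → rename (ext ρ) (↑ A) ≡ ↑ (rename ρ A)
  rename-ext-↑ ρ A = trans (rename-∘ (ext ρ) suc A) (sym (rename-∘ suc ρ A))

  exts-cong : σ ≗ τ → exts σ ≗ exts τ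
  exts-cong σ≗τ zero    = refl
  exts-cong σ≗τ (suc i) = cong ↑ (σ≗τ i)

  subst-cong : σ ≗ τ → subst σ ≗ subst τ
  subst-cong σ≗τ (tvar i) = σ≗τ i
  subst-cong σ≗τ (A ⇒ B)  = cong₂ _⇒_ (subst-cong σ≗τ A) (subst-cong σ≗τ B)
  subst-cong σ≗τ (∀̇ A)    = cong ∀̇ (subst-cong (exts-cong σ≗τ) A)
  subst-cong σ≗τ (α · A)  = cong (α ·_) (subst-cong σ≗τ A)
  subst-cong σ≗τ 𝟘        = refl

  rename-subst : ∀ ρ σ → rename ρ ∘ subst σ ≗ subst (rename ρ ∘ σ)
  rename-subst ρ σ (tvar i) = refl
  rename-subst ρ σ (A ⇒ B)  = cong₂ _⇒_ (rename-subst ρ σ A) (rename-subst ρ σ B)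
  rename-subst ρ σ (∀̇ A)    =
    cong ∀̇ (trans (rename-subst (ext ρ) (exts σ) A) (subst-cong exts-comm A))
    where
      exts-comm : rename (ext ρ) ∘ exts σ ≗ exts (rename ρ ∘ σ)
      exts-comm zero    = refl
      exts-comm (suc i) = rename-ext-↑ ρ (σ i)
  rename-subst ρ σ (α · A)  = cong (α ·_) (rename-subst ρ σ A)
  rename-subst ρ σ 𝟘        = refl

  subst-rename : ∀ σ f → subst σ ∘ rename f ≗ subst (σ ∘ f)
  subst-rename σ f (tvar i) = refl
  subst-rename σ f (A ⇒ B)  = cong₂ _⇒_ (subst-rename σ f A) (subst-rename σ f B)
  subst-rename σ f (∀̇ A)    =
    cong ∀̇ (trans (subst-rename (exts σ) (ext f) A) (subst-cong exts-ext A))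
    where
      exts-ext : exts σ ∘ ext f ≗ exts (σ ∘ f)
      exts-ext zero    = refl
      exts-ext (suc i) = refl
  subst-rename σ f (α · A)  = cong (α ·_) (subst-rename σ f A)
  subst-rename σ f 𝟘        = refl

  subst-tvar : σ ≗ tvar → ∀ A → subst σ A ≡ A
  subst-tvar σ≗tvar (tvar i) = σ≗tvar i
  subst-tvar σ≗tvar (A ⇒ B)  = cong₂ _⇒_ (subst-tvar σ≗tvar A) (subst-tvar σ≗tvar B)
  subst-tvar {σ} σ≗tvar (∀̇ A) = cong ∀̇ (subst-tvar exts-tvar A)
    where
      exts-tvar : exts σ ≗ tvar
      exts-tvar zero    = refl
      exts-tvar (suc i) = cong ↑ (σ≗tvar i)
  subst-tvar σ≗tvar (α · A)  = cong (α ·_) (subst-tvar σ≗tvar A)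
  subst-tvar σ≗tvar 𝟘        = refl

  rename-[] : ∀ ρ A U → rename ρ (A [ U ]) ≡ rename (ext ρ) A [ rename ρ U ]
  rename-[] ρ A U = trans (rename-subst ρ (single U) A)
    (trans (subst-cong single-ext A) (sym (subst-rename (single (rename ρ U)) (ext ρ) A)))
    where
      single-ext : rename ρ ∘ single U ≗ single (rename ρ U) ∘ ext ρ
      single-ext zero    = refl
      single-ext (suc i) = refl

  close-zero-[tvar-zero] : ∀ A → close 0 A [ tvar 0 ] ≡ A
  close-zero-[tvar-zero] A =
    trans (subst-rename (single (tvar 0)) (closeVar 0) A) (subst-tvar single-closeVar A)
    where
      single-closeVar : single (tvar 0) ∘ closeVar 0 ≗ tvar
      single-closeVar zero    = refl
      single-closeVar (suc i) = refl

  mutual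
    IsUnit-rename : ∀ ρ → IsUnit A → IsUnit (rename ρ A)
    IsUnit-rename ρ u-var       = u-var
    IsUnit-rename ρ (u-⇒ u t)   = u-⇒ (IsUnit-rename ρ u) (IsType-rename ρ t)
    IsUnit-rename ρ (u-∀ u)     = u-∀ (IsUnit-rename (ext ρ) u)

    IsType-rename : ∀ ρ → IsType A → IsType (rename ρ A)
    IsType-rename ρ (t-unit u) = t-unit (IsUnit-rename ρ u)
    IsType-rename ρ (t-∀ t)    = t-∀ (IsType-rename (ext ρ) t)
    IsType-rename ρ (t-· t)    = t-· (IsType-rename ρ t)
    IsType-rename ρ t-𝟘        = t-𝟘

  mutual
    IsUnit-subst⁻ : ∀ σ A → IsUnit (subst σ A) → IsUnit A
    IsUnit-subst⁻ σ (tvar i) _         = u-var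
    IsUnit-subst⁻ σ (A ⇒ B) (u-⇒ u t) = u-⇒ (IsUnit-subst⁻ σ A u) (IsType-subst⁻ σ B t)
    IsUnit-subst⁻ σ (∀̇ A)   (u-∀ u)   = u-∀ (IsUnit-subst⁻ (exts σ) A u)

    IsType-subst⁻ : ∀ σ A → IsType (subst σ A) → IsType A
    IsType-subst⁻ σ (tvar i) _          = t-unit u-var
    IsType-subst⁻ σ (A ⇒ B) (t-unit u) = t-unit (IsUnit-subst⁻ σ (A ⇒ B) u)
    IsType-subst⁻ σ (∀̇ A)   (t-unit u) = t-unit (IsUnit-subst⁻ σ (∀̇ A) u)
    IsType-subst⁻ σ (∀̇ A)   (t-∀ t)    = t-∀ (IsType-subst⁻ (exts σ) A t)
    IsType-subst⁻ σ (α · A) (t-· t)    = t-· (IsType-subst⁻ σ A t)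
    IsType-subst⁻ σ 𝟘       _          = t-𝟘

  IsType-⇒⁻ : IsType (A ⇒ B) → IsType B
  IsType-⇒⁻ (t-unit (u-⇒ _ t)) = t

  IsType-∀⁻ : IsType (∀̇ A) → IsType A
  IsType-∀⁻ (t-unit (u-∀ u)) = t-unit u
  IsType-∀⁻ (t-∀ t)          = t

  ≅-wf : A ≅ B → IsType A × IsType B
  ≅-wf ≅-zero-scal       = t-· t-𝟘 , t-𝟘
  ≅-wf (≅-scal-zero t)   = t-· t , t-𝟘
  ≅-wf (≅-one t)         = t-· t , t
  ≅-wf (≅-mul t)         = t-· (t-· t) , t-· t
  ≅-wf (≅-∀scal t)       = t-∀ (t-· t) , t-· (t-∀ t)
  ≅-wf (≅-refl t)        = t , t
  ≅-wf (≅-sym e)         = proj₂ (≅-wf e) , proj₁ (≅-wf e)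
  ≅-wf (≅-trans e e')    = proj₁ (≅-wf e) , proj₂ (≅-wf e')
  ≅-wf (≅-⇒ u u' _ e)    = t-unit (u-⇒ u (proj₁ (≅-wf e))) , t-unit (u-⇒ u' (proj₂ (≅-wf e)))
  ≅-wf (≅-∀ e)           = t-∀ (proj₁ (≅-wf e)) , t-∀ (proj₂ (≅-wf e))
  ≅-wf (≅-· _ e)         = t-· (proj₁ (≅-wf e)) , t-· (proj₂ (≅-wf e))

  ≅-rename : ∀ ρ → A ≅ B → rename ρ A ≅ rename ρ B
  ≅-rename ρ ≅-zero-scal        = ≅-zero-scal
  ≅-rename ρ (≅-scal-zero t)    = ≅-scal-zero (IsType-rename ρ t)
  ≅-rename ρ (≅-one t)          = ≅-one (IsType-rename ρ t)
  ≅-rename ρ (≅-mul t)          = ≅-mul (IsType-rename ρ t)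
  ≅-rename ρ (≅-∀scal t)        = ≅-∀scal (IsType-rename (ext ρ) t)
  ≅-rename ρ (≅-refl t)         = ≅-refl (IsType-rename ρ t)
  ≅-rename ρ (≅-sym e)          = ≅-sym (≅-rename ρ e)
  ≅-rename ρ (≅-trans e e')     = ≅-trans (≅-rename ρ e) (≅-rename ρ e')
  ≅-rename ρ (≅-⇒ u u' e e')    =
    ≅-⇒ (IsUnit-rename ρ u) (IsUnit-rename ρ u') (≅-rename ρ e) (≅-rename ρ e')
  ≅-rename ρ (≅-∀ e)            = ≅-∀ (≅-rename (ext ρ) e)
  ≅-rename ρ (≅-· α≈β e)        = ≅-· α≈β (≅-rename ρ e)

  ∋-map : ∀ (h : Ty → Ty) {i} → Γ ∋ i ∶ A → map h Γ ∋ i ∶ h A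
  ∋-map h here      = here
  ∋-map h (there x) = there (∋-map h x)

  ⊢-rename : ∀ ρ → Γ ⊢ t ∶ A [ n ] → map (rename ρ) Γ ⊢ t ∶ rename ρ A [ n ]
  ⊢-rename ρ (ax x)       = ax (∋-map (rename ρ) x)
  ⊢-rename ρ (≡-rule d e) = ≡-rule (⊢-rename ρ d) (≅-rename ρ e)
  ⊢-rename ρ (ac p d)     = ac p (⊢-rename ρ d)
  ⊢-rename ρ (→E d d')    = →E (⊢-rename ρ d) (⊢-rename ρ d')
  ⊢-rename ρ (→I u d)     = →I (IsUnit-rename ρ u) (⊢-rename ρ d)
  ⊢-rename {Γ = Γ} {t = t} {n = suc n} ρ (∀E {T = A} {U = U} u d) =
    ≡-subst (λ B → map (rename ρ) Γ ⊢ t ∶ B [ suc n ]) (sym (rename-[] ρ A U))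
      (∀E (IsUnit-rename ρ u) (⊢-rename ρ d))
  ⊢-rename {Γ = Γ} {t = t} {A = ∀̇ A} {n = suc n} ρ (∀I d) =
    ∀I (≡-subst (λ Δ → Δ ⊢ t ∶ rename (ext ρ) A [ n ]) ↑-commutes (⊢-rename (ext ρ) d))
    where
      ↑-commutes : map (rename (ext ρ)) (map ↑ Γ) ≡ map ↑ (map (rename ρ) Γ)
      ↑-commutes = trans (sym (map-∘ Γ)) (trans (map-cong (rename-ext-↑ ρ) Γ) (map-∘ Γ))
  ⊢-rename ρ ax𝟘          = ax𝟘
  ⊢-rename ρ (+I d d')    = +I (⊢-rename ρ d) (⊢-rename ρ d')
  ⊢-rename ρ (sI d)       = sI (⊢-rename ρ d)

  closeVar-self : ∀ k → closeVar k k ≡ zero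
  closeVar-self k with k ≟ k
  ... | yes _   = refl
  ... | no k≢k  = contradiction refl k≢k

  closeVar-other : ∀ {k i} → i ≢ k → closeVar k i ≡ suc i
  closeVar-other {k} {i} i≢k with i ≟ k
  ... | yes i≡k = contradiction i≡k i≢k
  ... | no _    = refl

  ext-closeVar : Injective _≡_ _≡_ ρ → ∀ k i → ext ρ (closeVar k i) ≡ closeVar (ρ k) (ρ i)
  ext-closeVar {ρ} inj k i with i ≟ k
  ... | yes refl = sym (closeVar-self (ρ k))
  ... | no i≢k   = sym (closeVar-other (i≢k ∘ inj))

  rename-close : Injective _≡_ _≡_ ρ →
                 ∀ k A → rename (ext ρ) (close k A) ≡ close (ρ k) (rename ρ A)
  rename-close {ρ} inj k A = trans (rename-∘ (ext ρ) (closeVar k) A)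
    (trans (rename-cong (ext-closeVar inj k) A) (sym (rename-∘ (closeVar (ρ k)) ρ A)))

  ≺-rename : Injective _≡_ _≡_ ρ → A ≺ B → rename ρ A ≺ rename ρ B
  ≺-rename {ρ} {A} {B} inj (inj₁ (k , B≅∀A)) =
    inj₁ (ρ k , ≡-subst (λ C → rename ρ B ≅ ∀̇ C) (rename-close inj k A) (≅-rename ρ B≅∀A))
  ≺-rename {ρ} {A} {B} inj (inj₂ (S , U , u , A≅∀S , B≅S[U])) =
    inj₂ (rename (ext ρ) S , rename ρ U , IsUnit-rename ρ u , ≅-rename ρ A≅∀S ,
          ≡-subst (rename ρ B ≅_) (rename-[] ρ S U) (≅-rename ρ B≅S[U]))

  -- Generalize over the variable 0 and instantiate it back with itself.
  ≅⇒⪯ : A ≅ B → A ⪯ B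
  ≅⇒⪯ {A} {B} A≅B = generalize ◅ instantiate ◅ ε
    where
      ∀A-wf : IsType (∀̇ (close 0 A))
      ∀A-wf = t-∀ (IsType-rename (closeVar 0) (proj₁ (≅-wf A≅B)))

      generalize : A ≺ ∀̇ (close 0 A)
      generalize = inj₁ (0 , ≅-refl ∀A-wf)

      instantiate : ∀̇ (close 0 A) ≺ B
      instantiate = inj₂ (close 0 A , tvar 0 , u-var , ≅-refl ∀A-wf ,
        ≡-subst (B ≅_) (sym (close-zero-[tvar-zero] A)) (≅-sym A≅B))

  fv-bound : Ty → ℕ
  fv-bound (tvar i) = suc i
  fv-bound (A ⇒ B)  = fv-bound A ⊔ℕ fv-bound B
  fv-bound (∀̇ A)    = pred (fv-bound A)
  fv-bound (α · A)  = fv-bound A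
  fv-bound 𝟘        = 0

  rename-id-on-fv : ∀ A → (∀ i → i < fv-bound A → f i ≡ i) → rename f A ≡ A
  rename-id-on-fv (tvar i) f-id = cong tvar (f-id i ≤-refl)
  rename-id-on-fv (A ⇒ B)  f-id = cong₂ _⇒_
    (rename-id-on-fv A (λ i i<A → f-id i (<-≤-trans i<A (m≤m⊔n (fv-bound A) (fv-bound B)))))
    (rename-id-on-fv B (λ i i<B → f-id i (<-≤-trans i<B (m≤n⊔m (fv-bound A) (fv-bound B)))))
  rename-id-on-fv {f} (∀̇ A) f-id = cong ∀̇ (rename-id-on-fv A ext-id)
    where
      ext-id : ∀ i → i < fv-bound A → ext f i ≡ i
      ext-id zero    _     = refl
      ext-id (suc i) 1+i<A = cong suc (f-id i (<⇒≤pred 1+i<A))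
  rename-id-on-fv (α · A)  f-id = cong (α ·_) (rename-id-on-fv A f-id)
  rename-id-on-fv 𝟘        f-id = refl

  -- The cyclic permutation (0 N N-1 … 1): it undoes the shift ↑ below N and sends 0 to N.
  cycle : ℕ → ℕ → ℕ
  cycle N zero    = N
  cycle N (suc i) with i <? N
  ... | yes _ = i
  ... | no _  = suc i

  cycle-suc : ∀ {N i} → i < N → cycle N (suc i) ≡ i
  cycle-suc {N} {i} i<N with i <? N
  ... | yes _  = refl
  ... | no i≮N = contradiction i<N i≮N

  closeVar-cycle : ∀ {N i} → i < N → closeVar N (cycle N i) ≡ i
  closeVar-cycle {N} {zero}  _     = closeVar-self N
  closeVar-cycle {N} {suc i} 1+i<N =
    trans (cong (closeVar N) (cycle-suc i<N)) (closeVar-other (<⇒≢ i<N))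
    where i<N = <-trans (n<1+n i) 1+i<N

  cycle-injective : ∀ N → Injective _≡_ _≡_ (cycle N)
  cycle-injective N {zero}  {zero}  _ = refl
  cycle-injective N {zero}  {suc j} e with j <? N
  ... | yes j<N = contradiction (sym e) (<⇒≢ j<N)
  ... | no j≮N  = contradiction (≡-subst (j <_) (sym e) (n<1+n j)) j≮N
  cycle-injective N {suc i} {zero}  e with i <? N
  ... | yes i<N = contradiction e (<⇒≢ i<N)
  ... | no i≮N  = contradiction (≡-subst (i <_) e (n<1+n i)) i≮N
  cycle-injective N {suc i} {suc j} e with i <? N | j <? N
  ... | yes _   | yes _   = cong suc e
  ... | yes i<N | no j≮N  = contradiction (<-trans (n<1+n j) (≡-subst (_< N) e i<N)) j≮N
  ... | no i≮N  | yes j<N = contradiction (<-trans (n<1+n i) (≡-subst (_< N) (sym e) j<N)) i≮N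
  ... | no _    | no _    = e

  rename-cycle-↑ : ∀ {N} → fv-bound A ≤ N → rename (cycle N) (↑ A) ≡ A
  rename-cycle-↑ {A} {N} A≤N = trans (rename-∘ (cycle N) suc A)
    (rename-id-on-fv A (λ i i<A → cycle-suc (<-≤-trans i<A A≤N)))

  close-rename-cycle : ∀ {N} → fv-bound A ≤ N → close N (rename (cycle N) A) ≡ A
  close-rename-cycle {A} {N} A≤N = trans (rename-∘ (closeVar N) (cycle N) A)
    (rename-id-on-fv A (λ i i<A → closeVar-cycle (<-≤-trans i<A A≤N)))

  ƛ-Inversion : Ctx → Tm → Ty → ℕ → Set (c ⊔ ℓ)
  ƛ-Inversion Γ t T n = Σ Ty λ U → Σ Ty λ R → Σ ℕ λ m →
    IsUnit U × IsType R × m < n × (U ∷ Γ) ⊢ t ∶ R [ m ] × (U ⇒ R) ⪯ T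

  ƛ-Inversion-⪯ : A ⪯ B → n ≤ n' → ƛ-Inversion Γ t A n → ƛ-Inversion Γ t B n'
  ƛ-Inversion-⪯ A⪯B n≤n' (U , R , m , u , r , m<n , d , U⇒R⪯A) =
    U , R , m , u , r , <-≤-trans m<n n≤n' , d , U⇒R⪯A ◅◅ A⪯B

  ƛ-Inversion-rename : Injective _≡_ _≡_ ρ →
    ƛ-Inversion Γ t A n → ƛ-Inversion (map (rename ρ) Γ) t (rename ρ A) n
  ƛ-Inversion-rename {ρ} inj (U , R , m , u , r , m<n , d , U⇒R⪯A) =
    rename ρ U , rename ρ R , m , IsUnit-rename ρ u , IsType-rename ρ r , m<n ,
    ⊢-rename ρ d , gmap (rename ρ) (≺-rename inj) U⇒R⪯A

  ƛ-Inversion-∀I : IsType (∀̇ A) →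
                   ƛ-Inversion (map ↑ Γ) t A n → ƛ-Inversion Γ t (∀̇ A) (suc n)
  ƛ-Inversion-∀I {A} {Γ} {t} {n} ∀A-wf inv =
    ƛ-Inversion-⪯ (generalize ◅ ε) (n≤1+n n)
      (≡-subst (λ Δ → ƛ-Inversion Δ t (rename (cycle N) A) n) unshift renamed)
    where
      N : ℕ
      N = max (fv-bound A) (map fv-bound Γ)

      renamed : ƛ-Inversion (map (rename (cycle N)) (map ↑ Γ)) t (rename (cycle N) A) n
      renamed = ƛ-Inversion-rename (cycle-injective N) inv

      Γ≤N : All (λ B → fv-bound B ≤ N) Γ
      Γ≤N = map⁻ (xs≤max (fv-bound A) (map fv-bound Γ))

      unshift : map (rename (cycle N)) (map ↑ Γ) ≡ Γ
      unshift = trans (sym (map-∘ Γ)) (map-id-local (All.map rename-cycle-↑ Γ≤N))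

      generalize : rename (cycle N) A ≺ ∀̇ A
      generalize = inj₁ (N , ≡-subst (λ B → ∀̇ A ≅ ∀̇ B)
        (sym (close-rename-cycle (⊥≤max (fv-bound A) (map fv-bound Γ)))) (≅-refl ∀A-wf))

  ƛ-inversion : IsType T → Γ ⊢ s ∶ T [ n ] → Pointwise _~_ (lamBody s) (just t) →
                ƛ-Inversion Γ t T n
  ƛ-inversion T-wf (ax _)      ()
  ƛ-inversion T-wf (≡-rule d A≅T) body =
    ƛ-Inversion-⪯ (≅⇒⪯ A≅T) ≤-refl (ƛ-inversion (proj₁ (≅-wf A≅T)) d body)
  ƛ-inversion T-wf (ac s~s' d) body =
    ƛ-inversion T-wf d (Pointwise.trans ~trans (lamBody-~ s~s') body)
  ƛ-inversion T-wf (→E _ _)    ()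
  ƛ-inversion T-wf (→I u d) (just t'~t) =
    _ , _ , _ , u , IsType-⇒⁻ T-wf , n<1+n _ , ac t'~t d , ε
  ƛ-inversion T-wf (∀E {T = A} {U = U} u d) body =
    ƛ-Inversion-⪯ (instantiate ◅ ε) (n≤1+n _) (ƛ-inversion ∀A-wf d body)
    where
      ∀A-wf : IsType (∀̇ A)
      ∀A-wf = t-∀ (IsType-subst⁻ (single U) A T-wf)

      instantiate : ∀̇ A ≺ A [ U ]
      instantiate = inj₂ (A , U , u , ≅-refl ∀A-wf , ≅-refl T-wf)
  ƛ-inversion T-wf (∀I d) body = ƛ-Inversion-∀I T-wf (ƛ-inversion (IsType-∀⁻ T-wf) d body)
  ƛ-inversion T-wf ax𝟘         ()
  ƛ-inversion T-wf (+I _ _)    ()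
  ƛ-inversion T-wf (sI _)      ()

mainTheorem10 : ∀ {c ℓ} (𝒮 : CommutativeRing c ℓ) → let open Lineal 𝒮 in
    (Γ : Ctx) (t : Tm) (T : Ty) (n : ℕ) → All IsUnit Γ → IsType T →
    Γ ⊢ ƛ t ∶ T [ n ] →
    Σ Ty λ U → Σ Ty λ R → Σ ℕ λ m →
    IsUnit U × IsType R × m < n × (U ∷ Γ) ⊢ t ∶ R [ m ] × (U ⇒ R) ⪯ T
mainTheorem10 𝒮 Γ t T n _ T-wf d = ƛ-inversion 𝒮 T-wf d (just Lineal.~refl)
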